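{- Let $S$ be a set, $f\colon 2^S\to 2^S$ monotonic with respect to $\subseteq$, and let $\mathcal{X}$ be a set of support orderings for $f$. Define $S_{\mathcal{X}}=\bigcup_{(X,\prec)\in\mathcal{X}}X$ and $\prec_{\mathcal{X}}=\bigcup_{(X,\prec)\in\mathcal{X}}\prec$. Then $(S_{\mathcal{X}},\prec_{\mathcal{X}})$ is a support ordering for $f$.
   Context: A support ordering for $f$ is a pair $(X,\prec)$ with $X\subseteq S$ and $\prec\subseteq X\times X$ a binary relation such that for every $x\in X$, $x\in f(\{x'\in X\mid x'\prec x\})$. -}

module Defs where

open import Level using (Level)
open import Data.Product using (Σ; _×_; _,_)
open import Relation.Unary using (Pred; _⊆_; _∈_)
open import Relation.Binary using (Rel)

Monotone : {ℓ : Level} {S : Set ℓ} → (Pred S ℓ → Pred S ℓ) → Set _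
Monotone {S = S} f = ∀ {A B : Pred S _} → A ⊆ B → f A ⊆ f B

record SupportOrdering {ℓ : Level} {S : Set ℓ} (f : Pred S ℓ → Pred S ℓ)
                       (X : Pred S ℓ) (_≺_ : Rel S ℓ) : Set ℓ where
  field
    rel⊆X×X : ∀ {x y} → x ≺ y → (x ∈ X × y ∈ X)
    supported : ∀ {x} → x ∈ X → x ∈ f (λ x' → x' ∈ X × x' ≺ x)

-- Union of an indexed family of support orderings (I indexes the set 𝒳).
⋃X : {ℓ : Level} {S : Set ℓ} {I : Set ℓ} → (I → Pred S ℓ) → Pred S ℓ
⋃X {I = I} Xs x = Σ I λ i → x ∈ Xs i

⋃≺ : {ℓ : Level} {S : Set ℓ} {I : Set ℓ} → (I → Rel S ℓ) → Rel S ℓ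
⋃≺ {I = I} Rs x y = Σ I λ i → Rs i x y

{-# OPTIONS --safe #-}
module Submission where

open import Defs
open import Level using (Level)
open import Data.Product using (_×_; _,_)
open import Relation.Unary using (Pred; _⊆_; _∈_)
open import Relation.Binary using (Rel)

module _ {ℓ : Level} {S I : Set ℓ} (Xs : I → Pred S ℓ) (Rs : I → Rel S ℓ) where

  predecessors⊆⋃-predecessors : ∀ i {x} →
    (λ x' → x' ∈ Xs i × Rs i x' x) ⊆ (λ x' → x' ∈ ⋃X Xs × ⋃≺ Rs x' x)
  predecessors⊆⋃-predecessors i (x'∈X , x'≺x) = (i , x'∈X) , (i , x'≺x)

  ⋃-rel⊆X×X : (∀ i {x y} → Rs i x y → x ∈ Xs i × y ∈ Xs i) →
              ∀ {x y} → ⋃≺ Rs x y → x ∈ ⋃X Xs × y ∈ ⋃X Xs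
  ⋃-rel⊆X×X rel⊆ (i , x≺y) with rel⊆ i x≺y
  ... | x∈X , y∈X = (i , x∈X) , (i , y∈X)

lemma9 : {ℓ : Level} {S : Set ℓ} (f : Pred S ℓ → Pred S ℓ) → Monotone f →
    (I : Set ℓ) (Xs : I → Pred S ℓ) (Rs : I → Rel S ℓ) →
    (∀ i → SupportOrdering f (Xs i) (Rs i)) →
    SupportOrdering f (⋃X Xs) (⋃≺ Rs)
lemma9 f mono I Xs Rs so = record
  { rel⊆X×X = ⋃-rel⊆X×X Xs Rs (λ i → SupportOrdering.rel⊆X×X (so i))
  ; supported = λ { (i , x∈X) →
      mono (predecessors⊆⋃-predecessors Xs Rs i) (SupportOrdering.supported (so i) x∈X) }
  }
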